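{- Let $m,n\in\mathbb{N}$ with $m\ge n$. There is exactly one dimension-preserving graph morphism $T_m\to T_n$ that is surjective on vertices.
   Context: A graph is $(V,E)$ with $E\subseteq V\times V$; a graph morphism $(V,E)\to(V',E')$ is $f:V\to V'$ with $(s,t)\in E\Rightarrow(f(s),f(t))\in E'$, sending the edge $(s,t)$ to the edge $(f(s),f(t))$. The twisted $n$-cube $T_n$ has vertex set $\{0,1\}^n$ and edges: a loop at each vertex, and for each $i\in\{0,\dots,n-1\}$ and $y\in\{0,1\}^{n-1}$ an edge from $y_0\cdots y_{i-1}\,b\,y_i\cdots y_{n-2}$ to $y_0\cdots y_{i-1}\,(1-b)\,y_i\cdots y_{n-2}$, where $b=1$ if the number of zeros among $y_0,\dots,y_{i-1}$ is odd and $b=0$ otherwise. The dimension of a loop is "trivial"; the dimension of a non-loop edge joining vertices that differ in coordinate $i$ is $i$. A graph morphism $f:T_m\to T_n$ is dimension-preserving if for any two edges $e_1,e_2$ of $T_m$ of equal dimension, $f(e_1)$ and $f(e_2)$ have equal dimension. -}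

module Defs where

open import Data.Nat using (ℕ; zero; suc; _≤_)
open import Data.Bool using (Bool; true; false; not; if_then_else_)
open import Data.Fin using (Fin; zero; suc)
open import Data.Vec using (Vec; []; _∷_; insertAt)
open import Data.Maybe using (Maybe; just; nothing; map)
open import Data.Product using (Σ; _×_; ∃)
open import Relation.Binary.PropositionalEquality using (_≡_)

-- Bits: false = 0, true = 1.  A vertex of T_n is a word in {0,1}^n.
Vertex : ℕ → Set
Vertex n = Vec Bool n

oddZerosBefore : ∀ {k} → Fin (suc k) → Vec Bool k → Bool
oddZerosBefore zero    y        = false
oddZerosBefore (suc i) (x ∷ y) = if x then oddZerosBefore i y else not (oddZerosBefore i y)

data Edge : ∀ {n} → Vertex n → Vertex n → Set where
  loop : ∀ {n} (v : Vertex n) → Edge v v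
  step : ∀ {k} (i : Fin (suc k)) (y : Vec Bool k) →
         Edge (insertAt y i (oddZerosBefore i y))
              (insertAt y i (not (oddZerosBefore i y)))

dim : ∀ {n} → Vertex n → Vertex n → Maybe (Fin n)
dim []       []       = nothing
dim (true  ∷ u) (false ∷ v) = just zero
dim (false ∷ u) (true  ∷ v) = just zero
dim (true  ∷ u) (true  ∷ v) = map suc (dim u v)
dim (false ∷ u) (false ∷ v) = map suc (dim u v)

IsGraphMorphism : ∀ {m n} → (Vertex m → Vertex n) → Set
IsGraphMorphism {m} f = ∀ {s t : Vertex m} → Edge s t → Edge (f s) (f t)

IsDimensionPreserving : ∀ {m n} → (Vertex m → Vertex n) → Set
IsDimensionPreserving {m} f =
  ∀ {s₁ t₁ s₂ t₂ : Vertex m} → Edge s₁ t₁ → Edge s₂ t₂ →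
  dim s₁ t₁ ≡ dim s₂ t₂ → dim (f s₁) (f t₁) ≡ dim (f s₂) (f t₂)

SurjectiveOnVertices : ∀ {m n} → (Vertex m → Vertex n) → Set
SurjectiveOnVertices {m} {n} f = ∀ (w : Vertex n) → ∃ λ (v : Vertex m) → f v ≡ w

IsDPSurjMorphism : ∀ m n → (Vertex m → Vertex n) → Set
IsDPSurjMorphism m n f =
  IsGraphMorphism f × IsDimensionPreserving f × SurjectiveOnVertices f

module Submission where

-- A graph morphism sends each arc (directed non-loop edge) to a loop or to
-- an arc, and dimension preservation makes the choice uniform in the
-- direction i: all i-arcs collapse, or all go, with their orientation, to
-- arcs of one direction σ(i).  Flipping coordinate i reverses the arcs of
-- every higher direction and keeps those of lower ones; pushed through the
-- morphism this puts all collapsed directions above the others and makes σ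
-- strictly increasing.  By surjectivity every target direction j is hit
-- (otherwise coordinate j of the image would be constant), so σ is the
-- identity on 0, …, n-1.  As a vertex is determined by which of its edges
-- point away from it, the morphism is truncation to the first n coordinates,
-- which is itself such a morphism.

open import Defs
open import Data.Nat using (ℕ; zero; suc; _≤_; _<_; z≤n; s≤s)
open import Data.Nat.Properties
  using (<-cmp; <-trans; <-≤-trans; <-irrefl; ≮⇒≥; _<?_; _≟_; m<n⇒m<1+n; n<1+n; m<1+n⇒m<n∨m≡n)
open import Data.Nat.Induction using (<-rec)
open import Data.Bool using (Bool; true; false; not)
open import Data.Bool.Properties using (not-involutive; not-injective; not-¬)
open import Data.Fin using (Fin; toℕ)
open import Data.Fin.Properties using (toℕ-injective)
open import Data.Vec using (Vec; []; _∷_; insertAt; replicate; truncate; padRight)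
open import Data.Vec.Properties using (truncate-padRight)
open import Data.Maybe using (Maybe; just; nothing; map)
open import Data.Maybe.Properties using (just-injective; map-injective)
open import Data.Product using (Σ; _×_; _,_; proj₁; proj₂; ∃; ∃₂)
open import Data.Sum using (_⊎_; inj₁; inj₂; [_,_])
open import Data.Empty using (⊥-elim)
open import Relation.Nullary using (¬_; yes; no)
open import Relation.Binary using (tri<; tri≈; tri>)
open import Relation.Binary.PropositionalEquality
  using (_≡_; _≢_; refl; sym; trans; cong; subst; subst₂; module ≡-Reasoning)
import Data.Fin as Fin

open ≡-Reasoning

-- Out of range, flipAt is the identity and bitAt is false.
flipAt : ∀ {n} → ℕ → Vertex n → Vertex n
flipAt _       []      = []
flipAt zero    (x ∷ v) = not x ∷ v
flipAt (suc i) (x ∷ v) = x ∷ flipAt i v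

bitAt : ∀ {n} → ℕ → Vertex n → Bool
bitAt _       []      = false
bitAt zero    (x ∷ _) = x
bitAt (suc j) (_ ∷ v) = bitAt j v

flipAt-comm : ∀ {n} i k (v : Vertex n) → flipAt i (flipAt k v) ≡ flipAt k (flipAt i v)
flipAt-comm _       _       []      = refl
flipAt-comm zero    zero    (x ∷ v) = refl
flipAt-comm zero    (suc k) (x ∷ v) = refl
flipAt-comm (suc i) zero    (x ∷ v) = refl
flipAt-comm (suc i) (suc k) (x ∷ v) = cong (x ∷_) (flipAt-comm i k v)

bitAt-flipAt-≡ : ∀ {n} j (v : Vertex n) → j < n → bitAt j (flipAt j v) ≡ not (bitAt j v)
bitAt-flipAt-≡ zero    (x ∷ v) _         = refl
bitAt-flipAt-≡ (suc j) (x ∷ v) (s≤s j<n) = bitAt-flipAt-≡ j v j<n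

bitAt-flipAt-≢ : ∀ {n} i j (v : Vertex n) → i ≢ j → bitAt j (flipAt i v) ≡ bitAt j v
bitAt-flipAt-≢ _       _       []      _   = refl
bitAt-flipAt-≢ zero    zero    (x ∷ v) i≢j = ⊥-elim (i≢j refl)
bitAt-flipAt-≢ zero    (suc j) (x ∷ v) _   = refl
bitAt-flipAt-≢ (suc i) zero    (x ∷ v) _   = refl
bitAt-flipAt-≢ (suc i) (suc j) (x ∷ v) i≢j = bitAt-flipAt-≢ i j v (λ i≡j → i≢j (cong suc i≡j))

flipAt-invariant⇒constant : ∀ {A : Set} m (f : Vertex m → A) →
  (∀ i → i < m → ∀ v → f (flipAt i v) ≡ f v) → ∀ u v → f u ≡ f v
flipAt-invariant⇒constant zero    f _   []      []      = refl
flipAt-invariant⇒constant (suc m) f inv (x ∷ u) (y ∷ v) =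
  trans (change-head x y)
        (flipAt-invariant⇒constant m (λ w → f (y ∷ w))
          (λ i i<m w → inv (suc i) (s≤s i<m) (y ∷ w)) u v)
  where
  change-head : ∀ x y → f (x ∷ u) ≡ f (y ∷ u)
  change-head true  true  = refl
  change-head false false = refl
  change-head true  false = inv zero (s≤s z≤n) (false ∷ u)
  change-head false true  = inv zero (s≤s z≤n) (true ∷ u)

bounded-search : ∀ {P Q : ℕ → Set} k → (∀ i → i < k → P i ⊎ Q i) →
  (∃ λ i → i < k × P i) ⊎ (∀ i → i < k → Q i)
bounded-search zero    _   = inj₂ (λ _ ())
bounded-search (suc k) P⊎Q with bounded-search k (λ i i<k → P⊎Q i (m<n⇒m<1+n i<k))
... | inj₁ (i , i<k , p) = inj₁ (i , m<n⇒m<1+n i<k , p)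
... | inj₂ Q-below with P⊎Q k (n<1+n k)
...   | inj₁ p = inj₁ (k , n<1+n k , p)
...   | inj₂ q = inj₂ (λ i i<1+k → [ Q-below i , (λ { refl → q }) ] (m<1+n⇒m<n∨m≡n i<1+k))

-- Arc i s t is the edge of T_n from s to t in direction i.  A leading 0
-- reverses the orientation of every later direction; this is the parity
-- bit oddZerosBefore of the definition of T_n.
data Arc : ∀ {n} → ℕ → Vertex n → Vertex n → Set where
  here    : ∀ {n} {v : Vertex n} → Arc zero (false ∷ v) (true ∷ v)
  true-∷  : ∀ {n i} {s t : Vertex n} → Arc i s t → Arc (suc i) (true ∷ s) (true ∷ t)
  false-∷ : ∀ {n i} {s t : Vertex n} → Arc i t s → Arc (suc i) (false ∷ s) (false ∷ t)

Arc-target : ∀ {n i} {s t : Vertex n} → Arc i s t → t ≡ flipAt i s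
Arc-source : ∀ {n i} {s t : Vertex n} → Arc i s t → s ≡ flipAt i t
Arc-target here        = refl
Arc-target (true-∷ a)  = cong (true ∷_) (Arc-target a)
Arc-target (false-∷ a) = cong (false ∷_) (Arc-source a)
Arc-source here        = refl
Arc-source (true-∷ a)  = cong (true ∷_) (Arc-source a)
Arc-source (false-∷ a) = cong (false ∷_) (Arc-target a)

Arc⇒< : ∀ {n i} {s t : Vertex n} → Arc i s t → i < n
Arc⇒< here        = s≤s z≤n
Arc⇒< (true-∷ a)  = s≤s (Arc⇒< a)
Arc⇒< (false-∷ a) = s≤s (Arc⇒< a)

Arc-asym : ∀ {n i j} {s t : Vertex n} → Arc i s t → ¬ Arc j t s
Arc-asym (true-∷ a)  (true-∷ b)  = Arc-asym a b
Arc-asym (false-∷ a) (false-∷ b) = Arc-asym a b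

Arc-total : ∀ {n} i (v : Vertex n) → i < n → Arc i v (flipAt i v) ⊎ Arc i (flipAt i v) v
Arc-total zero    (false ∷ v) _ = inj₁ here
Arc-total zero    (true ∷ v)  _ = inj₂ here
Arc-total (suc i) (true ∷ v) (s≤s i<n) with Arc-total i v i<n
... | inj₁ a = inj₁ (true-∷ a)
... | inj₂ a = inj₂ (true-∷ a)
Arc-total (suc i) (false ∷ v) (s≤s i<n) with Arc-total i v i<n
... | inj₁ a = inj₂ (false-∷ a)
... | inj₂ a = inj₁ (false-∷ a)

Arc-inhabited : ∀ {n i} → i < n → ∃₂ (Arc {n} i)
Arc-inhabited {suc n} {zero}  _         = _ , _ , here {v = replicate n true}
Arc-inhabited {suc n} {suc i} (s≤s i<n) with Arc-inhabited i<n
... | _ , _ , a = _ , _ , true-∷ a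

Arc-flipAt-above : ∀ {n i k} {s t : Vertex n} → i < k → Arc i s t → Arc i (flipAt k s) (flipAt k t)
Arc-flipAt-above {k = suc k} _         here        = here
Arc-flipAt-above {k = suc k} (s≤s i<k) (true-∷ a)  = true-∷ (Arc-flipAt-above i<k a)
Arc-flipAt-above {k = suc k} (s≤s i<k) (false-∷ a) = false-∷ (Arc-flipAt-above i<k a)

Arc-flipAt-below : ∀ {n i k} {s t : Vertex n} → i < k → Arc k s t → Arc k (flipAt i t) (flipAt i s)
Arc-flipAt-below {i = zero}  _         (true-∷ a)  = false-∷ a
Arc-flipAt-below {i = zero}  _         (false-∷ a) = true-∷ a
Arc-flipAt-below {i = suc i} (s≤s i<k) (true-∷ a)  = true-∷ (Arc-flipAt-below i<k a)
Arc-flipAt-below {i = suc i} (s≤s i<k) (false-∷ a) = false-∷ (Arc-flipAt-below i<k a)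

Arc-bitAt-≢ : ∀ {n l j} {u w : Vertex n} → Arc l u w → l ≢ j → bitAt j w ≡ bitAt j u
Arc-bitAt-≢ {l = l} {j} {u} a l≢j = trans (cong (bitAt j) (Arc-target a)) (bitAt-flipAt-≢ l j u l≢j)

Arc-parallel-sides : ∀ {n i k} {s t : Vertex n} → i < k → Arc k s t →
  (Arc i s (flipAt i s) × Arc i t (flipAt i t)) ⊎ (Arc i (flipAt i s) s × Arc i (flipAt i t) t)
Arc-parallel-sides {i = i} {k} {s} i<k a
  rewrite Arc-target a | flipAt-comm i k s with Arc-total i s (<-trans i<k (Arc⇒< a))
... | inj₁ b = inj₁ (b , Arc-flipAt-above i<k b)
... | inj₂ b = inj₂ (b , Arc-flipAt-above i<k b)

-- Translating along a direction j > l would keep the two l-sides parallel.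
antiparallel-square : ∀ {n j l} {a b c d : Vertex n} →
  Arc l a b → Arc l d c → Arc j a c → Arc j b d → j < l
antiparallel-square {j = j} {l} ab dc ac bd with <-cmp j l
... | tri< j<l _ _ = j<l
... | tri≈ _ refl _ =
  ⊥-elim (Arc-asym ab (subst (Arc _ _) (trans (Arc-target bd) (sym (Arc-source ab))) bd))
... | tri> _ _ l<j =
  ⊥-elim (Arc-asym dc (subst₂ (Arc _) (sym (Arc-target ac)) (sym (Arc-target bd))
                                      (Arc-flipAt-above l<j ab)))

isSource : ∀ {n} → ℕ → Vertex n → Bool
isSource _       []          = false
isSource zero    (x ∷ _)     = not x
isSource (suc i) (true ∷ v)  = isSource i v
isSource (suc i) (false ∷ v) = not (isSource i v)

Arc⇒isSource-source : ∀ {n i} {s t : Vertex n} → Arc i s t → isSource i s ≡ true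
Arc⇒isSource-target : ∀ {n i} {s t : Vertex n} → Arc i s t → isSource i t ≡ false
Arc⇒isSource-source here        = refl
Arc⇒isSource-source (true-∷ a)  = Arc⇒isSource-source a
Arc⇒isSource-source (false-∷ a) = cong not (Arc⇒isSource-target a)
Arc⇒isSource-target here        = refl
Arc⇒isSource-target (true-∷ a)  = Arc⇒isSource-target a
Arc⇒isSource-target (false-∷ a) = cong not (Arc⇒isSource-source a)

isSource-injective : ∀ {n} {u v : Vertex n} →
  (∀ i → i < n → isSource i u ≡ isSource i v) → u ≡ v
isSource-injective {u = []}    {[]}    _ = refl
isSource-injective {u = x ∷ u} {y ∷ v} same with not-injective (same zero (s≤s z≤n))
... | refl = cong (x ∷_) (isSource-injective λ i i<n → drop-head x (same (suc i) (s≤s i<n)))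
  where
  drop-head : ∀ {i} x → isSource (suc i) (x ∷ u) ≡ isSource (suc i) (x ∷ v) → isSource i u ≡ isSource i v
  drop-head true  eq = eq
  drop-head false eq = not-injective eq

dim-refl : ∀ {n} (v : Vertex n) → dim v v ≡ nothing
dim-refl []          = refl
dim-refl (true ∷ v)  = cong (map Fin.suc) (dim-refl v)
dim-refl (false ∷ v) = cong (map Fin.suc) (dim-refl v)

dim-sym : ∀ {n} (u v : Vertex n) → dim u v ≡ dim v u
dim-sym []          []          = refl
dim-sym (true ∷ u)  (true ∷ v)  = cong (map Fin.suc) (dim-sym u v)
dim-sym (true ∷ u)  (false ∷ v) = refl
dim-sym (false ∷ u) (true ∷ v)  = refl
dim-sym (false ∷ u) (false ∷ v) = cong (map Fin.suc) (dim-sym u v)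

map-suc≡nothing : ∀ {n} {x : Maybe (Fin n)} → map Fin.suc x ≡ nothing → x ≡ nothing
map-suc≡nothing {x = nothing} _ = refl

dim≡nothing⇒≡ : ∀ {n} (u v : Vertex n) → dim u v ≡ nothing → u ≡ v
dim≡nothing⇒≡ []          []          _  = refl
dim≡nothing⇒≡ (true ∷ u)  (true ∷ v)  eq = cong (true ∷_) (dim≡nothing⇒≡ u v (map-suc≡nothing eq))
dim≡nothing⇒≡ (false ∷ u) (false ∷ v) eq = cong (false ∷_) (dim≡nothing⇒≡ u v (map-suc≡nothing eq))
dim≡nothing⇒≡ (true ∷ u)  (false ∷ v) ()
dim≡nothing⇒≡ (false ∷ u) (true ∷ v)  ()

map-toℕ-suc : ∀ {n i} (x : Maybe (Fin n)) → map toℕ x ≡ just i → map toℕ (map Fin.suc x) ≡ just (suc i)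
map-toℕ-suc (just k) refl = refl

dim-Arc : ∀ {n i} {s t : Vertex n} → Arc i s t → map toℕ (dim s t) ≡ just i
dim-Arc here = refl
dim-Arc {s = true ∷ s} {true ∷ t} (true-∷ a) = map-toℕ-suc (dim s t) (dim-Arc a)
dim-Arc {s = false ∷ s} {false ∷ t} (false-∷ a) =
  map-toℕ-suc (dim s t) (trans (cong (map toℕ) (dim-sym s t)) (dim-Arc a))

dim-Arc-≡ : ∀ {n i} {s t s′ t′ : Vertex n} → Arc i s t → Arc i s′ t′ → dim s t ≡ dim s′ t′
dim-Arc-≡ a b = map-injective toℕ-injective (trans (dim-Arc a) (sym (dim-Arc b)))

dim-Arc-injective : ∀ {n i j} {s t s′ t′ : Vertex n} →
  Arc i s t → Arc j s′ t′ → dim s t ≡ dim s′ t′ → i ≡ j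
dim-Arc-injective a b eq = just-injective (trans (sym (dim-Arc a)) (trans (cong (map toℕ) eq) (dim-Arc b)))

dim-Arc≢nothing : ∀ {n i} {s t : Vertex n} → Arc i s t → dim s t ≢ nothing
dim-Arc≢nothing a eq with trans (sym (dim-Arc a)) (cong (map toℕ) eq)
... | ()

Arc-dim-unique : ∀ {n i j} {s t : Vertex n} → Arc i s t → Arc j s t → i ≡ j
Arc-dim-unique a b = dim-Arc-injective a b refl

step-Arc : ∀ {k} (i : Fin (suc k)) (y : Vertex k) →
  Arc (toℕ i) (insertAt y i (oddZerosBefore i y)) (insertAt y i (not (oddZerosBefore i y)))
step-Arc Fin.zero    y          = here
step-Arc (Fin.suc i) (true ∷ y) = true-∷ (step-Arc i y)
step-Arc (Fin.suc i) (false ∷ y) rewrite not-involutive (oddZerosBefore i y) = false-∷ (step-Arc i y)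

Edge⇒Arc : ∀ {n} {s t : Vertex n} → Edge s t → s ≡ t ⊎ ∃ λ i → Arc i s t
Edge⇒Arc (loop v)   = inj₁ refl
Edge⇒Arc (step i y) = inj₂ (toℕ i , step-Arc i y)

Arc⇒Edge : ∀ {n i} {s t : Vertex n} → Arc i s t → Edge s t
Arc⇒Edge here        = step Fin.zero _
Arc⇒Edge (true-∷ a)  = true-∷-Edge (Arc⇒Edge a)
  where
  true-∷-Edge : ∀ {n} {s t : Vertex n} → Edge s t → Edge (true ∷ s) (true ∷ t)
  true-∷-Edge (loop v)   = loop (true ∷ v)
  true-∷-Edge (step i y) = step (Fin.suc i) (true ∷ y)
Arc⇒Edge (false-∷ a) = false-∷-Edge (Arc⇒Edge a)
  where
  false-∷-Edge : ∀ {n} {s t : Vertex n} → Edge t s → Edge (false ∷ s) (false ∷ t)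
  false-∷-Edge (loop v)   = loop (false ∷ v)
  false-∷-Edge (step i y) =
    subst (Edge _) (cong (λ b → false ∷ insertAt y i b) (not-involutive (oddZerosBefore i y)))
          (step (Fin.suc i) (false ∷ y))

Edge-with-Arc-dim : ∀ {n j} {u v u′ v′ : Vertex n} →
  Edge u v → Arc j u′ v′ → dim u v ≡ dim u′ v′ → Arc j u v
Edge-with-Arc-dim {u = u} e b eq with Edge⇒Arc e
... | inj₁ refl    = ⊥-elim (dim-Arc≢nothing b (trans (sym eq) (dim-refl u)))
... | inj₂ (_ , a) = subst (λ i → Arc i _ _) (dim-Arc-injective a b eq) a

module _ {m n} (h : Vertex m → Vertex n) where

  Collapses : ℕ → Set
  Collapses i = ∀ v → h (flipAt i v) ≡ h v

  Sends : ℕ → ℕ → Set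
  Sends i j = ∀ {s t} → Arc i s t → Arc j (h s) (h t)

  Classified : Set
  Classified = ∀ i → i < m → Collapses i ⊎ ∃ (Sends i)

  Collapses-Arc : ∀ {i s t} → Collapses i → Arc i s t → h s ≡ h t
  Collapses-Arc {i} {s} c a = trans (sym (c s)) (cong h (sym (Arc-target a)))

  Classified-Arc-dim-≡ : Classified → ∀ {i s t s′ t′} → Arc i s t → Arc i s′ t′ →
    dim (h s) (h t) ≡ dim (h s′) (h t′)
  Classified-Arc-dim-≡ cl {i} {t = t} {t′ = t′} a b with cl i (Arc⇒< a)
  ... | inj₁ c rewrite Collapses-Arc c a | Collapses-Arc c b = trans (dim-refl (h t)) (sym (dim-refl (h t′)))
  ... | inj₂ (_ , σ) = dim-Arc-≡ (σ a) (σ b)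

  Classified⇒IsGraphMorphism : Classified → IsGraphMorphism h
  Classified⇒IsGraphMorphism cl e with Edge⇒Arc e
  ... | inj₁ refl = loop _
  ... | inj₂ (i , a) with cl i (Arc⇒< a)
  ...   | inj₁ c       = subst (Edge _) (Collapses-Arc c a) (loop _)
  ...   | inj₂ (_ , σ) = Arc⇒Edge (σ a)

  Classified⇒IsDimensionPreserving : Classified → IsDimensionPreserving h
  Classified⇒IsDimensionPreserving cl {s₁} {_} {s₂} e₁ e₂ eq with Edge⇒Arc e₁ | Edge⇒Arc e₂
  ... | inj₁ refl | inj₁ refl = trans (dim-refl (h s₁)) (sym (dim-refl (h s₂)))
  ... | inj₁ refl | inj₂ (_ , b) = ⊥-elim (dim-Arc≢nothing b (trans (sym eq) (dim-refl s₁)))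
  ... | inj₂ (_ , a) | inj₁ refl = ⊥-elim (dim-Arc≢nothing a (trans eq (dim-refl s₂)))
  ... | inj₂ (_ , a) | inj₂ (_ , b) with dim-Arc-injective a b eq
  ...   | refl = Classified-Arc-dim-≡ cl a b

  Sends-unique : ∀ {i j j′} → i < m → Sends i j → Sends i j′ → j ≡ j′
  Sends-unique i<m σ σ′ with Arc-inhabited i<m
  ... | _ , _ , a = Arc-dim-unique (σ a) (σ′ a)

  Collapses⇒¬Sends-above : ∀ {i k l} → i < k → k < m → Collapses i → ¬ Sends k l
  Collapses⇒¬Sends-above {i} i<k k<m c σ with Arc-inhabited k<m
  ... | s , t , a = Arc-asym (σ a) (subst₂ (Arc _) (c t) (c s) (σ (Arc-flipAt-below i<k a)))

  Sends-monotone : ∀ {i k j l} → i < k → k < m → Sends i j → Sends k l → j < l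
  Sends-monotone i<k k<m σi σk with Arc-inhabited k<m
  ... | _ , _ , a with Arc-parallel-sides i<k a
  ...   | inj₁ (b , b′) = antiparallel-square (σk a) (σk (Arc-flipAt-below i<k a)) (σi b) (σi b′)
  ...   | inj₂ (b , b′) = antiparallel-square (σk (Arc-flipAt-below i<k a)) (σk a) (σi b′) (σi b)

  Sends-other-preserves-bitAt : ∀ {i l j} → i < m → Sends i l → l ≢ j →
    ∀ v → bitAt j (h (flipAt i v)) ≡ bitAt j (h v)
  Sends-other-preserves-bitAt {i} i<m σ l≢j v with Arc-total i v i<m
  ... | inj₁ a = Arc-bitAt-≢ (σ a) l≢j
  ... | inj₂ a = sym (Arc-bitAt-≢ (σ a) l≢j)

  Classified⇒Sends-or-preserves-bitAt : Classified → ∀ {j} i → i < m →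
    Sends i j ⊎ (∀ v → bitAt j (h (flipAt i v)) ≡ bitAt j (h v))
  Classified⇒Sends-or-preserves-bitAt cl {j} i i<m with cl i i<m
  ... | inj₁ c = inj₂ (λ v → cong (bitAt j) (c v))
  ... | inj₂ (l , σ) with l ≟ j
  ...   | yes refl = inj₁ σ
  ...   | no l≢j   = inj₂ (Sends-other-preserves-bitAt i<m σ l≢j)

  Surjective⇒Sends : Classified → SurjectiveOnVertices h → ∀ {j} → j < n → ∃ λ i → i < m × Sends i j
  Surjective⇒Sends cl surj {j} j<n with bounded-search m (Classified⇒Sends-or-preserves-bitAt cl)
  ... | inj₁ found = found
  ... | inj₂ keeps = ⊥-elim (not-¬ refl bit-flips)
    where
    w : Vertex n
    w = replicate n false
    bit-flips : bitAt j w ≡ not (bitAt j w)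
    bit-flips = begin
      bitAt j w                                ≡⟨ cong (bitAt j) (proj₂ (surj w)) ⟨
      bitAt j (h (proj₁ (surj w)))             ≡⟨ flipAt-invariant⇒constant m (λ v → bitAt j (h v)) keeps _ _ ⟩
      bitAt j (h (proj₁ (surj (flipAt j w))))  ≡⟨ cong (bitAt j) (proj₂ (surj (flipAt j w))) ⟩
      bitAt j (flipAt j w)                     ≡⟨ bitAt-flipAt-≡ j w j<n ⟩
      not (bitAt j w)                          ∎

  Sends-id : Classified → SurjectiveOnVertices h → ∀ j → j < n → Sends j j
  Sends-id cl surj = <-rec (λ j → j < n → Sends j j) induction-step
    where
    induction-step : ∀ j → (∀ {j′} → j′ < j → j′ < n → Sends j′ j′) → j < n → Sends j j
    induction-step j IH j<n with Surjective⇒Sends cl surj j<n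
    ... | i , i<m , σ with <-cmp i j
    ...   | tri< i<j _ _  = ⊥-elim (<-irrefl (Sends-unique i<m (IH i<j (<-trans i<j j<n)) σ) i<j)
    ...   | tri≈ _ refl _ = σ
    ...   | tri> _ _ j<i with cl j (<-trans j<i i<m)
    ...     | inj₁ c       = ⊥-elim (Collapses⇒¬Sends-above j<i i<m c σ)
    ...     | inj₂ (l , σ′) = ⊥-elim (<-irrefl refl
                (Sends-monotone l<j (<-trans j<i i<m) (IH l<j (<-trans l<j j<n)) σ′))
      where
      l<j : l < j
      l<j = Sends-monotone j<i i<m σ′ σ

  Sends-id⇒isSource-≡ : ∀ {i} → i < m → Sends i i → ∀ v → isSource i (h v) ≡ isSource i v
  Sends-id⇒isSource-≡ {i} i<m σ v with Arc-total i v i<m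
  ... | inj₁ a = trans (Arc⇒isSource-source (σ a)) (sym (Arc⇒isSource-source a))
  ... | inj₂ a = trans (Arc⇒isSource-target (σ a)) (sym (Arc⇒isSource-target a))

Sends-id-unique : ∀ {m n} → n ≤ m → (h h′ : Vertex m → Vertex n) →
  (∀ j → j < n → Sends h j j) → (∀ j → j < n → Sends h′ j j) → ∀ v → h v ≡ h′ v
Sends-id-unique n≤m h h′ σ σ′ v = isSource-injective λ j j<n →
  let j<m = <-≤-trans j<n n≤m in
  trans (Sends-id⇒isSource-≡ h j<m (σ j j<n) v) (sym (Sends-id⇒isSource-≡ h′ j<m (σ′ j j<n) v))

module _ {m n} {g : Vertex m → Vertex n} (gm : IsGraphMorphism g) (gd : IsDimensionPreserving g) where

  image-dim-≡ : ∀ {i} {s t s′ t′} → Arc i s t → Arc i s′ t′ → dim (g s) (g t) ≡ dim (g s′) (g t′)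
  image-dim-≡ a b = gd (Arc⇒Edge a) (Arc⇒Edge b) (dim-Arc-≡ a b)

  dimensionPreserving⇒Classified : Classified g
  dimensionPreserving⇒Classified i i<m with Arc-inhabited i<m
  ... | s₀ , t₀ , a₀ with Edge⇒Arc (gm (Arc⇒Edge a₀))
  ...   | inj₂ (j , b) = inj₂ (j , λ a → Edge-with-Arc-dim (gm (Arc⇒Edge a)) b (image-dim-≡ a a₀))
  ...   | inj₁ g-s₀≡g-t₀ = inj₁ collapses
    where
    image-trivial : ∀ {s t} → Arc i s t → g s ≡ g t
    image-trivial {s} {t} a = dim≡nothing⇒≡ (g s) (g t)
      (trans (image-dim-≡ a a₀) (trans (cong (dim (g s₀)) (sym g-s₀≡g-t₀)) (dim-refl (g s₀))))
    collapses : Collapses g i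
    collapses v with Arc-total i v i<m
    ... | inj₁ a = sym (image-trivial a)
    ... | inj₂ a = image-trivial a

truncate-Arc : ∀ {m n i} (n≤m : n ≤ m) {s t : Vertex m} → i < n → Arc i s t →
  Arc i (truncate n≤m s) (truncate n≤m t)
truncate-Arc (s≤s n≤m) _         here        = here
truncate-Arc (s≤s n≤m) (s≤s i<n) (true-∷ a)  = true-∷ (truncate-Arc n≤m i<n a)
truncate-Arc (s≤s n≤m) (s≤s i<n) (false-∷ a) = false-∷ (truncate-Arc n≤m i<n a)

truncate-flipAt : ∀ {m n i} (n≤m : n ≤ m) → n ≤ i → ∀ v → truncate n≤m (flipAt i v) ≡ truncate n≤m v
truncate-flipAt z≤n       _         _       = refl
truncate-flipAt (s≤s n≤m) (s≤s n≤i) (x ∷ v) = cong (x ∷_) (truncate-flipAt n≤m n≤i v)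

truncate-Classified : ∀ {m n} (n≤m : n ≤ m) → Classified (truncate n≤m)
truncate-Classified {n = n} n≤m i _ with i <? n
... | yes i<n = inj₂ (i , truncate-Arc n≤m i<n)
... | no  i≮n = inj₁ (truncate-flipAt n≤m (≮⇒≥ i≮n))

truncate-surjective : ∀ {m n} (n≤m : n ≤ m) → SurjectiveOnVertices (truncate n≤m)
truncate-surjective n≤m w = padRight n≤m false w , truncate-padRight n≤m false w

theorem3p10 : ∀ (m n : ℕ) → n ≤ m →
    Σ (Vertex m → Vertex n) λ f →
      IsDPSurjMorphism m n f ×
      (∀ (g : Vertex m → Vertex n) → IsDPSurjMorphism m n g → ∀ v → g v ≡ f v)
theorem3p10 m n n≤m = truncate n≤m , truncate-isDPSurj , unique
  where
  truncate-isDPSurj : IsDPSurjMorphism m n (truncate n≤m)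
  truncate-isDPSurj = Classified⇒IsGraphMorphism _ (truncate-Classified n≤m)
                    , Classified⇒IsDimensionPreserving _ (truncate-Classified n≤m)
                    , truncate-surjective n≤m
  unique : ∀ g → IsDPSurjMorphism m n g → ∀ v → g v ≡ truncate n≤m v
  unique g (gm , gd , gs) = Sends-id-unique n≤m g (truncate n≤m)
    (Sends-id g (dimensionPreserving⇒Classified gm gd) gs)
    (λ j j<n → truncate-Arc n≤m j<n)
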